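{- Let $F$ be a connected digraph which is either a digraph-function or the inverse of a digraph-function, let $C$ be the unique directed cycle of $F$, let $n=v(F)$ be the number of vertices of $F$ and $k=v(C)$ the number of vertices of $C$. Then (a1) $A(\lambda , F) = \lambda ^{n - k} A(\lambda , C) = \lambda ^{n - k} (\lambda ^k - 1)$, and (a2) if $F$ is simple (i.e. $k\ge 2$), then $A(\lambda, F^c) = (\lambda + 1)^{n - k} (\lambda - n + 2) (\lambda + 2)^{ -1} ((\lambda + 1)^k - (-1)^k)$.
   Context: A digraph is $D=(V,E)$ with $V$ finite nonempty and $E\subseteq V\times V$ (loops allowed, no multiple arcs); it is simple if it has no loops. $D$ is connected if its underlying undirected graph is connected. $D$ is a digraph-function if there is a function $f:V\to V$ with $(x,y)\in E$ iff $y=f(x)$; the inverse of $D$ is $(V,\{(y,x):(x,y)\in E\})$. A connected digraph-function or its inverse contains exactly one directed cycle (possibly a loop, i.e. a cycle with one vertex). $A(\lambda,G)=\det(\lambda I-A(G))$ with $A(G)$ the 0/1 adjacency matrix. For a simple digraph $F$ on vertex set $V$, its complement $F^c$ is the digraph on $V$ with arcs all $(u,v)$, $u\neq v$, not in $E(F)$. -}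

module Defs where

open import Data.Nat as ℕ using (ℕ; zero; suc; _∸_; _%_)
open import Data.Integer using (ℤ; +_; -_; _+_; _*_; _-_; _^_)
open import Data.Fin using (Fin; zero; suc; toℕ; punchIn; _≟_)
open import Data.Bool using (Bool; true; false; if_then_else_; not; _∧_)
open import Data.Product using (Σ; _×_; _,_; ∃)
open import Data.Sum using (_⊎_)
open import Relation.Binary.PropositionalEquality using (_≡_)
open import Relation.Nullary.Decidable using (⌊_⌋)
open import Function.Bundles using (_⇔_)
open import Function.Definitions using (Injective)

-- A digraph on the vertex set Fin n: E u v ≡ true iff (u,v) is an arc.
-- (Loops allowed; no multiple arcs.)
Digraph : ℕ → Set
Digraph n = Fin n → Fin n → Bool

adjMatrix : ∀ {n} → Digraph n → Fin n → Fin n → ℤ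
adjMatrix E i j = if E i j then + 1 else + 0

sumFin : ∀ {n} → (Fin n → ℤ) → ℤ
sumFin {zero}  f = + 0
sumFin {suc n} f = f zero + sumFin (λ i → f (suc i))

det : ∀ {n} → (Fin n → Fin n → ℤ) → ℤ
det {zero}  M = + 1
det {suc n} M =
  sumFin (λ j → ((- (+ 1)) ^ toℕ j) * M zero j
                 * det (λ r c → M (suc r) (punchIn j c)))

-- A(λ, G) = det(λ I - A(G)), evaluated at the integer λ
charPoly : ∀ {n} → Digraph n → ℤ → ℤ
charPoly E λ′ = det (λ i j → (if ⌊ i ≟ j ⌋ then λ′ else + 0) - adjMatrix E i j)

data Conn {n} (E : Digraph n) : Fin n → Fin n → Set where
  here : ∀ {u} → Conn E u u
  fwd  : ∀ {u v w} → E v w ≡ true → Conn E u v → Conn E u w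
  bwd  : ∀ {u v w} → E w v ≡ true → Conn E u v → Conn E u w

Connected : ∀ {n} → Digraph n → Set
Connected E = ∀ u v → Conn E u v

IsDigraphFunction : ∀ {n} → Digraph n → Set
IsDigraphFunction {n} E = Σ (Fin n → Fin n) λ f → ∀ x y → (E x y ≡ true) ⇔ (y ≡ f x)

inverse : ∀ {n} → Digraph n → Digraph n
inverse E x y = E y x

IsInverseOfDigraphFunction : ∀ {n} → Digraph n → Set
IsInverseOfDigraphFunction E = IsDigraphFunction (inverse E)

Simple : ∀ {n} → Digraph n → Set
Simple E = ∀ x → E x x ≡ false

complement : ∀ {n} → Digraph n → Digraph n
complement E u v = not (E u v) ∧ not ⌊ u ≟ v ⌋

cycleDigraph : ∀ m → Digraph (suc m)
cycleDigraph m i j = ⌊ toℕ j ℕ.≟ (suc (toℕ i) % suc m) ⌋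

IsDirectedCycle : ∀ {n} → Digraph n → ∀ m → (Fin (suc m) → Fin n) → Set
IsDirectedCycle E m v =
  Injective _≡_ _≡_ v × (∀ i j → cycleDigraph m i j ≡ true → E (v i) (v j) ≡ true)

module Submission where

-- For a digraph function F of f, a vertex off the cycle that is not in the image of f has no incoming arc, so its
-- column in λI − A(F) is λ times a unit vector and deleting the vertex divides A(λ, F) by λ. Since F is connected,
-- every vertex reaches the cycle under f, so such a vertex exists until only the cycle is left; this gives
-- A(λ, F) = λ^(n−k) A(λ, C), and inverses of digraph functions reduce to it by transposition. For the complement,
-- λI − A(Fᶜ) = B − J with B = (λ + 1)I + A(F) and J the all-ones matrix. All row sums of B equal λ + 2, so the
-- matrix determinant lemma gives (λ + 2) det(B − J) = (λ + 2 − n) det B, and det B = (−1)ⁿ A(−λ − 1, F).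

open import Defs
open import Data.Nat as ℕ using (ℕ; zero; suc; _∸_; _⊔_; _≤_; _<_; s≤s; _≡ᵇ_; _%_)
open import Data.Nat.DivMod using (n%n≡0; m≤n⇒m%n≡m; m%n<n)
import Data.Nat.Properties as ℕ
open import Data.Integer using (ℤ; +_; -_; _+_; _*_; _-_; _^_)
open import Data.Integer.Properties using (+-identityʳ; +-comm; +-assoc; ^-distribˡ-+-*; *-zeroʳ; *-zeroˡ; pos-+)
open import Data.Integer.Tactic.RingSolver using (solve-∀)
open import Data.Fin using (Fin; zero; suc; toℕ; fromℕ; fromℕ<; inject₁; punchIn; punchOut; lift; _≟_)
open import Data.Fin.Properties
  using (toℕ-fromℕ; toℕ-fromℕ<; toℕ-inject₁; toℕ<n; any?; all?; ¬∀⟶∃¬; injective⇒≤; suc-injective;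
         punchIn-injective; punchInᵢ≢i; punchIn-punchOut; punchOut-injective)
open import Data.Bool using (Bool; true; false; if_then_else_; not; _∧_)
open import Data.Bool.Properties using (¬-not)
open import Data.Product using (Σ; _×_; _,_; ∃; proj₁; proj₂)
open import Data.Sum using (_⊎_; inj₁; inj₂)
open import Data.Empty using (⊥-elim)
open import Relation.Nullary using (Dec; yes; no; ¬_)
open import Relation.Nullary.Decidable using (⌊_⌋; isYes≗does; dec-true; dec-false; does-⇔)
open import Relation.Binary.PropositionalEquality
open import Function.Definitions using (Injective)
open import Function.Bundles using (_⇔_; mk⇔; Equivalence)
open import Data.Vec.Functional using (updateAt)
open import Data.Vec.Functional.Properties using (updateAt-updates; updateAt-minimal)

-- Finite sums

sumFin-cong : ∀ {n} {f g : Fin n → ℤ} → (∀ i → f i ≡ g i) → sumFin f ≡ sumFin g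
sumFin-cong {zero}  e = refl
sumFin-cong {suc n} e = cong₂ _+_ (e zero) (sumFin-cong (λ i → e (suc i)))

sumFin-+ : ∀ {n} (f g : Fin n → ℤ) → sumFin (λ i → f i + g i) ≡ sumFin f + sumFin g
sumFin-+ {zero}  f g = refl
sumFin-+ {suc n} f g =
  trans (cong (_+_ (f zero + g zero)) (sumFin-+ (λ i → f (suc i)) (λ i → g (suc i))))
        (interchange (f zero) (g zero) _ _)
  where
  interchange : ∀ a b c d → a + b + (c + d) ≡ a + c + (b + d)
  interchange = solve-∀

sumFin-*ˡ : ∀ {n} (c : ℤ) (f : Fin n → ℤ) → sumFin (λ i → c * f i) ≡ c * sumFin f
sumFin-*ˡ {zero}  c f = sym (*-zeroʳ c)
sumFin-*ˡ {suc n} c f =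
  trans (cong (_+_ (c * f zero)) (sumFin-*ˡ c (λ i → f (suc i)))) (distrib c (f zero) _)
  where
  distrib : ∀ c a b → c * a + c * b ≡ c * (a + b)
  distrib = solve-∀

sumFin-neg : ∀ {n} (f : Fin n → ℤ) → sumFin (λ i → - f i) ≡ - sumFin f
sumFin-neg {zero}  f = refl
sumFin-neg {suc n} f =
  trans (cong (_+_ (- f zero)) (sumFin-neg (λ i → f (suc i)))) (neg-distrib (f zero) _)
  where
  neg-distrib : ∀ a b → - a + - b ≡ - (a + b)
  neg-distrib = solve-∀

sumFin-zero : ∀ {n} (f : Fin n → ℤ) → (∀ i → f i ≡ + 0) → sumFin f ≡ + 0
sumFin-zero {zero}  f e = refl
sumFin-zero {suc n} f e
  rewrite e zero | sumFin-zero (λ i → f (suc i)) (λ i → e (suc i)) = refl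

sumFin-const : ∀ {n} (c : ℤ) → sumFin {n} (λ _ → c) ≡ + n * c
sumFin-const {zero}  c = sym (*-zeroˡ c)
sumFin-const {suc n} c =
  trans (cong (_+_ c) (sumFin-const {n} c))
        (trans (step c (+ n)) (cong (_* c) (sym (pos-+ 1 n))))
  where
  step : ∀ c m → c + m * c ≡ (+ 1 + m) * c
  step = solve-∀

sumFin-comm : ∀ {m n} (f : Fin m → Fin n → ℤ) →
  sumFin (λ i → sumFin (f i)) ≡ sumFin (λ j → sumFin (λ i → f i j))
sumFin-comm {zero}  {n} f = sym (sumFin-zero {n} (λ _ → + 0) (λ _ → refl))
sumFin-comm {suc m} f =
  trans (cong (_+_ (sumFin (f zero))) (sumFin-comm (λ i → f (suc i))))
        (sym (sumFin-+ (f zero) (λ j → sumFin (λ i → f (suc i) j))))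

sumFin-punchIn : ∀ {n} (f : Fin (suc n) → ℤ) i → sumFin f ≡ f i + sumFin (λ k → f (punchIn i k))
sumFin-punchIn f zero = refl
sumFin-punchIn {suc n} f (suc i) =
  trans (cong (_+_ (f zero)) (sumFin-punchIn (λ k → f (suc k)) i)) (swap (f zero) (f (suc i)) _)
  where
  swap : ∀ a b c → a + (b + c) ≡ b + (a + c)
  swap = solve-∀

sumFin-single : ∀ {n} (f : Fin (suc n) → ℤ) i → (∀ k → f (punchIn i k) ≡ + 0) → sumFin f ≡ f i
sumFin-single f i zeros =
  trans (sumFin-punchIn f i) (trans (cong (_+_ (f i)) (sumFin-zero _ zeros)) (+-identityʳ (f i)))

-- Determinants

Matrix : ℕ → Set
Matrix n = Fin n → Fin n → ℤ

sign : ∀ {n} → Fin n → ℤ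
sign j = (- (+ 1)) ^ toℕ j

-1^k*-1^k≡1 : ∀ k → (- (+ 1)) ^ k * (- (+ 1)) ^ k ≡ + 1
-1^k*-1^k≡1 zero    = refl
-1^k*-1^k≡1 (suc k) = trans (square-neg ((- (+ 1)) ^ k)) (-1^k*-1^k≡1 k)
  where
  square-neg : ∀ x → (- (+ 1)) * x * ((- (+ 1)) * x) ≡ x * x
  square-neg = solve-∀

minor : ∀ {n} → Fin (suc n) → Matrix (suc n) → Matrix n
minor j M r c = M (suc r) (punchIn j c)

transpose : ∀ {n} → Matrix n → Matrix n
transpose M i j = M j i

det-cong : ∀ {n} {M N : Matrix n} → (∀ i j → M i j ≡ N i j) → det M ≡ det N
det-cong {zero}  e = refl
det-cong {suc n} e = sumFin-cong (λ j →
  cong₂ _*_ (cong (sign j *_) (e zero j)) (det-cong (λ r c → e (suc r) (punchIn j c))))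

det-expandColumn₀ : ∀ {n} (M : Matrix (suc n)) →
  det M ≡ sumFin (λ i → sign i * M i zero * det (λ r c → M (punchIn i r) (suc c)))
det-expandColumn₀ {zero}  M = refl
det-expandColumn₀ {suc n} M =
  cong (_+_ (sign {suc (suc n)} zero * M zero zero * det (minor zero M))) tail
  where
  open ≡-Reasoning
  D : Fin (suc n) → Fin (suc n) → Matrix n
  D i j r c = M (suc (punchIn i r)) (suc (punchIn j c))
  exchange : ∀ a b x y d → ((- (+ 1)) * a) * x * (b * y * d) ≡ ((- (+ 1)) * b) * y * (a * x * d)
  exchange = solve-∀
  tail : sumFin (λ j → sign (suc j) * M zero (suc j) * det (minor (suc j) M))
       ≡ sumFin (λ i → sign (suc i) * M (suc i) zero * det (λ r c → M (punchIn (suc i) r) (suc c)))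
  tail = begin
    sumFin (λ j → sign (suc j) * M zero (suc j) * det (minor (suc j) M))
      ≡⟨ sumFin-cong (λ j → cong (sign (suc j) * M zero (suc j) *_) (det-expandColumn₀ (minor (suc j) M))) ⟩
    sumFin (λ j → sign (suc j) * M zero (suc j) * sumFin (λ i → sign i * M (suc i) zero * det (D i j)))
      ≡⟨ sumFin-cong (λ j → sym (sumFin-*ˡ (sign (suc j) * M zero (suc j))
                                             (λ i → sign i * M (suc i) zero * det (D i j)))) ⟩
    sumFin (λ j → sumFin (λ i → sign (suc j) * M zero (suc j) * (sign i * M (suc i) zero * det (D i j))))
      ≡⟨ sumFin-comm (λ j i → sign (suc j) * M zero (suc j) * (sign i * M (suc i) zero * det (D i j))) ⟩
    sumFin (λ i → sumFin (λ j → sign (suc j) * M zero (suc j) * (sign i * M (suc i) zero * det (D i j))))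
      ≡⟨ sumFin-cong (λ i → sumFin-cong (λ j →
           exchange (sign j) (sign i) (M zero (suc j)) (M (suc i) zero) (det (D i j)))) ⟩
    sumFin (λ i → sumFin (λ j → sign (suc i) * M (suc i) zero * (sign j * M zero (suc j) * det (D i j))))
      ≡⟨ sumFin-cong (λ i → sumFin-*ˡ (sign (suc i) * M (suc i) zero)
                                      (λ j → sign j * M zero (suc j) * det (D i j))) ⟩
    sumFin (λ i → sign (suc i) * M (suc i) zero * det (λ r c → M (punchIn (suc i) r) (suc c)))
      ∎

det-transpose : ∀ {n} (M : Matrix n) → det (transpose M) ≡ det M
det-transpose {zero}  M = refl
det-transpose {suc n} M = trans
  (sumFin-cong (λ j → cong (sign j * M j zero *_) (det-transpose (λ r c → M (punchIn j r) (suc c)))))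
  (sym (det-expandColumn₀ M))

det-neg : ∀ {n} (M : Matrix n) → det (λ i j → - M i j) ≡ (- (+ 1)) ^ n * det M
det-neg {zero}  M = refl
det-neg {suc n} M =
  trans (sumFin-cong (λ j → trans (cong (sign j * - M zero j *_) (det-neg (minor j M)))
                                  (pull (sign j) (M zero j) ((- (+ 1)) ^ n) (det (minor j M)))))
        (sumFin-*ˡ ((- (+ 1)) ^ suc n) (λ j → sign j * M zero j * det (minor j M)))
  where
  pull : ∀ s m p d → s * - m * (p * d) ≡ (- (+ 1)) * p * (s * m * d)
  pull = solve-∀

det-column₀-single : ∀ {n} (M : Matrix (suc n)) → (∀ r → M (suc r) zero ≡ + 0) →
  det M ≡ M zero zero * det (minor zero M)
det-column₀-single {n} M zeros =
  trans (det-expandColumn₀ M)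
    (trans (sumFin-single column zero (λ r → trans (cong (λ x → sign (suc r) * x * cofactor (suc r)) (zeros r))
                                                   (vanish (sign (suc r)) (cofactor (suc r)))))
           (unit (M zero zero) (cofactor zero)))
  where
  cofactor : Fin (suc n) → ℤ
  cofactor i = det (λ r c → M (punchIn i r) (suc c))
  column : Fin (suc n) → ℤ
  column i = sign i * M i zero * cofactor i
  vanish : ∀ s d → s * + 0 * d ≡ + 0
  vanish = solve-∀
  unit : ∀ a d → + 1 * a * d ≡ a * d
  unit = solve-∀

swap₀₁ : ∀ {n} → Fin (suc (suc n)) → Fin (suc (suc n))
swap₀₁ zero          = suc zero
swap₀₁ (suc zero)    = zero
swap₀₁ (suc (suc i)) = suc (suc i)

det-swapColumns₀₁ : ∀ {n} (M : Matrix (suc (suc n))) → det (λ i j → M i (swap₀₁ j)) ≡ - det M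
det-swapColumns₀₁ {n} M =
  trans (cong₂ _+_ (cong (sign {suc (suc n)} zero * M zero (suc zero) *_) minor₀)
                   (cong₂ _+_ (cong (sign {suc (suc n)} (suc zero) * M zero zero *_) minor₁) (tail n M)))
        (rearrange (M zero (suc zero)) (M zero zero) (det (minor (suc zero) M)) (det (minor zero M))
                   (sumFin (λ j → sign (suc (suc j)) * M zero (suc (suc j)) * det (minor (suc (suc j)) M))))
  where
  rearrange : ∀ b a X Y T → + 1 * b * X + ((- (+ 1)) * + 1 * a * Y + - T)
                          ≡ - (+ 1 * a * Y + ((- (+ 1)) * + 1 * b * X + T))
  rearrange = solve-∀
  swap-suc : ∀ c → swap₀₁ {n} (suc c) ≡ punchIn (suc zero) c
  swap-suc zero    = refl
  swap-suc (suc c) = refl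
  swap-punchIn₁ : ∀ c → swap₀₁ {n} (punchIn (suc zero) c) ≡ punchIn zero c
  swap-punchIn₁ zero    = refl
  swap-punchIn₁ (suc c) = refl
  minor₀ : det (minor zero (λ i j → M i (swap₀₁ j))) ≡ det (minor (suc zero) M)
  minor₀ = det-cong (λ r c → cong (M (suc r)) (swap-suc c))
  minor₁ : det (minor (suc zero) (λ i j → M i (swap₀₁ j))) ≡ det (minor zero M)
  minor₁ = det-cong (λ r c → cong (M (suc r)) (swap-punchIn₁ c))
  tail : ∀ n (M : Matrix (suc (suc n))) →
    sumFin (λ j → sign (suc (suc j)) * M zero (suc (suc j)) * det (minor (suc (suc j)) (λ i j → M i (swap₀₁ j))))
    ≡ - sumFin (λ j → sign (suc (suc j)) * M zero (suc (suc j)) * det (minor (suc (suc j)) M))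
  tail zero    M = refl
  tail (suc n) M =
    trans (sumFin-cong λ j → trans
            (cong (sign (suc (suc j)) * M zero (suc (suc j)) *_)
                  (trans (det-cong (λ r c → cong (M (suc r)) (swap-punchIn j c)))
                         (det-swapColumns₀₁ (minor (suc (suc j)) M))))
            (*-neg (sign (suc (suc j)) * M zero (suc (suc j))) (det (minor (suc (suc j)) M))))
          (sumFin-neg (λ j → sign (suc (suc j)) * M zero (suc (suc j)) * det (minor (suc (suc j)) M)))
    where
    *-neg : ∀ a b → a * - b ≡ - (a * b)
    *-neg = solve-∀
    swap-punchIn : ∀ (j : Fin (suc n)) c → swap₀₁ (punchIn (suc (suc j)) c) ≡ punchIn (suc (suc j)) (swap₀₁ c)
    swap-punchIn j zero          = refl
    swap-punchIn j (suc zero)    = refl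
    swap-punchIn j (suc (suc c)) = refl

det-swapRows₀₁ : ∀ {n} (M : Matrix (suc (suc n))) → det (λ i j → M (swap₀₁ i) j) ≡ - det M
det-swapRows₀₁ M =
  trans (sym (det-transpose (λ i j → M (swap₀₁ i) j)))
        (trans (det-swapColumns₀₁ (transpose M)) (cong -_ (det-transpose M)))

det-liftRows : ∀ {n} (τ : Fin n → Fin n) (s : ℤ) →
  (∀ (M : Matrix n) → det (λ i j → M (τ i) j) ≡ s * det M) →
  ∀ (M : Matrix (suc n)) → det (λ i j → M (lift 1 τ i) j) ≡ s * det M
det-liftRows τ s τ-scales M =
  trans (sumFin-cong (λ j → trans (cong (sign j * M zero j *_) (τ-scales (minor j M)))
                                  (commute (sign j * M zero j) s (det (minor j M)))))
        (sumFin-*ˡ s (λ j → sign j * M zero j * det (minor j M)))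
  where
  commute : ∀ a s d → a * (s * d) ≡ s * (a * d)
  commute = solve-∀

toFront : ∀ {n} → Fin (suc n) → Fin (suc n) → Fin (suc n)
toFront u zero    = u
toFront u (suc i) = punchIn u i

toFront-injective : ∀ {n} (u : Fin (suc n)) → Injective _≡_ _≡_ (toFront u)
toFront-injective u {zero}  {zero}  e = refl
toFront-injective u {zero}  {suc j} e = ⊥-elim (punchInᵢ≢i u j (sym e))
toFront-injective u {suc i} {zero}  e = ⊥-elim (punchInᵢ≢i u i e)
toFront-injective u {suc i} {suc j} e = cong suc (punchIn-injective u i j e)

det-toFront : ∀ {n} (u : Fin (suc n)) (M : Matrix (suc n)) → det (λ i j → M (toFront u i) j) ≡ sign u * det M
det-toFront zero M = trans (det-cong rows) (sym (unit (det M)))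
  where
  rows : ∀ i j → M (toFront zero i) j ≡ M i j
  rows zero    j = refl
  rows (suc i) j = refl
  unit : ∀ d → + 1 * d ≡ d
  unit = solve-∀
det-toFront {suc n} (suc u) M =
  trans (det-cong rows)
    (trans (det-swapRows₀₁ (λ i j → M (lift 1 (toFront u) i) j))
      (trans (cong -_ (det-liftRows (toFront u) (sign u) (det-toFront u) M))
             (neg-sign (sign u) (det M))))
  where
  rows : ∀ i j → M (toFront (suc u) i) j ≡ M (lift 1 (toFront u) (swap₀₁ i)) j
  rows zero          j = refl
  rows (suc zero)    j = refl
  rows (suc (suc i)) j = refl
  neg-sign : ∀ s d → - (s * d) ≡ (- (+ 1)) * s * d
  neg-sign = solve-∀

sign*sign≡1 : ∀ {n} (u : Fin n) → sign u * sign u ≡ + 1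
sign*sign≡1 u = -1^k*-1^k≡1 (toℕ u)

-- σ is σ zero moved to the front, followed by a permutation of the remaining rows.
det-permuteRows : ∀ {n} (σ : Fin n → Fin n) → Injective _≡_ _≡_ σ →
  Σ ℤ λ s → (s * s ≡ + 1) × (∀ (M : Matrix n) → det (λ i j → M (σ i) j) ≡ s * det M)
det-permuteRows {zero}  σ σ-inj = + 1 , refl , λ M → refl
det-permuteRows {suc n} σ σ-inj = s * sign (σ zero) , square , permutes
  where
  σ₀≢σsuc : ∀ i → σ zero ≢ σ (suc i)
  σ₀≢σsuc i eq with σ-inj eq
  ... | ()
  σ′ : Fin n → Fin n
  σ′ i = punchOut (σ₀≢σsuc i)
  σ′-inj : Injective _≡_ _≡_ σ′
  σ′-inj {i} {j} eq = suc-injective (σ-inj (punchOut-injective (σ₀≢σsuc i) (σ₀≢σsuc j) eq))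
  rest = det-permuteRows σ′ σ′-inj
  s = proj₁ rest
  square : s * sign (σ zero) * (s * sign (σ zero)) ≡ + 1
  square = trans (regroup s (sign (σ zero)))
                 (cong₂ _*_ (proj₁ (proj₂ rest)) (sign*sign≡1 (σ zero)))
    where
    regroup : ∀ a b → a * b * (a * b) ≡ (a * a) * (b * b)
    regroup = solve-∀
  factor : ∀ (M : Matrix (suc n)) i j → M (σ i) j ≡ M (toFront (σ zero) (lift 1 σ′ i)) j
  factor M zero    j = refl
  factor M (suc i) j = cong (λ x → M x j) (sym (punchIn-punchOut (σ₀≢σsuc i)))
  permutes : ∀ (M : Matrix (suc n)) → det (λ i j → M (σ i) j) ≡ s * sign (σ zero) * det M
  permutes M =
    trans (det-cong (factor M))
      (trans (det-liftRows σ′ s (proj₂ (proj₂ rest)) (λ i j → M (toFront (σ zero) i) j))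
        (trans (cong (s *_) (det-toFront (σ zero) M)) (assoc s (sign (σ zero)) (det M))))
    where
    assoc : ∀ a b d → a * (b * d) ≡ a * b * d
    assoc = solve-∀

det-relabel : ∀ {n} (σ : Fin n → Fin n) → Injective _≡_ _≡_ σ →
  ∀ (M : Matrix n) → det (λ i j → M (σ i) (σ j)) ≡ det M
det-relabel σ σ-inj M with det-permuteRows σ σ-inj
... | s , s*s≡1 , permutes =
  trans (permutes (λ i j → M i (σ j)))
    (trans (cong (s *_) (trans (sym (det-transpose (λ i j → M i (σ j))))
                               (trans (permutes (transpose M)) (cong (s *_) (det-transpose M)))))
      (trans (assoc s (det M)) (trans (cong (_* det M) s*s≡1) (unit (det M)))))
  where
  assoc : ∀ s d → s * (s * d) ≡ s * s * d
  assoc = solve-∀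
  unit : ∀ d → + 1 * d ≡ d
  unit = solve-∀

det-column-single : ∀ {n} (M : Matrix (suc n)) (u : Fin (suc n)) → (∀ r → M (punchIn u r) u ≡ + 0) →
  det M ≡ M u u * det (λ r c → M (punchIn u r) (punchIn u c))
det-column-single M u zeros =
  trans (sym (det-relabel (toFront u) (toFront-injective u) M))
        (det-column₀-single (λ i j → M (toFront u i) (toFront u j)) zeros)

x≡-x⇒x≡0 : ∀ (x : ℤ) → x ≡ - x → x ≡ + 0
x≡-x⇒x≡0 (+ zero)     e = refl
x≡-x⇒x≡0 (+ (suc n))  ()
x≡-x⇒x≡0 (ℤ.negsuc n) ()

-- Bringing row suc r next to row zero, swapping them changes nothing and negates the determinant.
det-equalRows₀ : ∀ {n} (M : Matrix (suc n)) (r : Fin n) → (∀ j → M zero j ≡ M (suc r) j) → det M ≡ + 0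
det-equalRows₀ {suc n} M r same =
  trans (sym (unit (det M)))
    (trans (cong (_* det M) (sym (sign*sign≡1 r)))
      (trans (sym (assoc (sign r) (det M)))
        (trans (cong (sign r *_) (trans (sym moved) moved≡0)) (*-zeroʳ (sign r)))))
  where
  unit : ∀ d → + 1 * d ≡ d
  unit = solve-∀
  assoc : ∀ s d → s * (s * d) ≡ (s * s) * d
  assoc = solve-∀
  K : Matrix (suc (suc n))
  K i j = M (lift 1 (toFront r) i) j
  moved : det K ≡ sign r * det M
  moved = det-liftRows (toFront r) (sign r) (det-toFront r) M
  K-swap : ∀ i j → K (swap₀₁ i) j ≡ K i j
  K-swap zero          j = sym (same j)
  K-swap (suc zero)    j = same j
  K-swap (suc (suc i)) j = refl
  moved≡0 : det K ≡ + 0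
  moved≡0 = x≡-x⇒x≡0 (det K) (trans (sym (det-cong K-swap)) (det-swapRows₀₁ K))

replaceRow : ∀ {m n} → (Fin m → Fin n → ℤ) → Fin m → (Fin n → ℤ) → Fin m → Fin n → ℤ
replaceRow M r w = updateAt M r (λ _ → w)

replaceRow-mapColumns : ∀ {m n k} (M : Fin m → Fin n → ℤ) (g : Fin k → Fin n) r w r′ c →
  replaceRow M r w r′ (g c) ≡ replaceRow (λ i c → M i (g c)) r (λ c → w (g c)) r′ c
replaceRow-mapColumns M g zero    w zero     c = refl
replaceRow-mapColumns M g zero    w (suc r′) c = refl
replaceRow-mapColumns M g (suc r) w zero     c = refl
replaceRow-mapColumns M g (suc r) w (suc r′) c = replaceRow-mapColumns (λ i → M (suc i)) g r w r′ c

-- Replacing row zero by the sum of all rows adds determinants with two equal rows.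
det-columnSums : ∀ {n} (X : Matrix (suc n)) →
  sumFin (λ j → sign j * sumFin (λ r → X r j) * det (minor j X)) ≡ det X
det-columnSums X = begin
  sumFin (λ j → sign j * sumFin (λ r → X r j) * det (minor j X))
    ≡⟨ sumFin-cong (λ j → distribute (sign j) (det (minor j X)) (λ r → X r j)) ⟩
  sumFin (λ j → sumFin (λ r → sign j * X r j * det (minor j X)))
    ≡⟨ sumFin-comm (λ j r → sign j * X r j * det (minor j X)) ⟩
  sumFin (λ r → det (replaceRow X zero (X r)))
    ≡⟨ cong (_+_ (det X))
            (sumFin-zero _ (λ r → det-equalRows₀ (replaceRow X zero (X (suc r))) r (λ j → refl))) ⟩
  det X + + 0
    ≡⟨ +-identityʳ (det X) ⟩
  det X ∎
  where
  open ≡-Reasoning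
  distribute : ∀ {n} (a d : ℤ) (f : Fin n → ℤ) → a * sumFin f * d ≡ sumFin (λ r → a * f r * d)
  distribute a d f =
    trans (move a (sumFin f) d) (trans (sym (sumFin-*ˡ (a * d) f)) (sumFin-cong (λ r → back a d (f r))))
    where
    move : ∀ a s d → a * s * d ≡ (a * d) * s
    move = solve-∀
    back : ∀ a d x → (a * d) * x ≡ a * x * d
    back = solve-∀

det-addToRows : ∀ {n} (M : Matrix (suc n)) (w : Fin (suc n) → ℤ) →
  det (λ i j → M i j + w j) ≡ det M + sumFin (λ i → det (replaceRow M i w))
det-addToRows {zero} M w = expand (M zero zero) (w zero)
  where
  expand : ∀ a b → + 1 * (a + b) * + 1 + + 0 ≡ (+ 1 * a * + 1 + + 0) + (+ 1 * b * + 1 + + 0 + + 0)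
  expand = solve-∀
det-addToRows {suc n} M w = begin
  det (λ i j → M i j + w j)
    ≡⟨ sumFin-cong (λ j → trans (cong (sign j * (M zero j + w j) *_) (det-addToRows (minor j M) (w′ j)))
                               (expand (sign j) (M zero j) (w j) (D j) (sumFin (E j)))) ⟩
  sumFin (λ j → t₁ j + t₂ j + t₃ j + t₄ j)
    ≡⟨ trans (sumFin-+ (λ j → t₁ j + t₂ j + t₃ j) t₄)
             (cong (_+ sumFin t₄) (trans (sumFin-+ (λ j → t₁ j + t₂ j) t₃) (cong (_+ sumFin t₃) (sumFin-+ t₁ t₂)))) ⟩
  sumFin t₁ + sumFin t₂ + sumFin t₃ + sumFin t₄
    ≡⟨ cong₂ _+_ (cong (_+_ (sumFin t₁ + sumFin t₂)) (replaced (M zero))) (replaced w) ⟩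
  sumFin t₁ + sumFin t₂ + sumFin (λ r → det (replaceRow M (suc r) w))
    + sumFin (λ r → det (replaceRow (replaceRow M (suc r) w) zero w))
    ≡⟨ cong (_+_ (sumFin t₁ + sumFin t₂ + sumFin (λ r → det (replaceRow M (suc r) w))))
            (sumFin-zero _ (λ r → det-equalRows₀ (replaceRow (replaceRow M (suc r) w) zero w) r
                                   (λ j → sym (cong (λ v → v j) (updateAt-updates r (λ k → M (suc k))))))) ⟩
  sumFin t₁ + sumFin t₂ + sumFin (λ r → det (replaceRow M (suc r) w)) + + 0
    ≡⟨ regroup (sumFin t₁) (sumFin t₂) (sumFin (λ r → det (replaceRow M (suc r) w))) ⟩
  det M + sumFin (λ i → det (replaceRow M i w)) ∎
  where
  open ≡-Reasoning
  w′ : Fin (suc (suc n)) → Fin (suc n) → ℤ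
  w′ j c = w (punchIn j c)
  D : Fin (suc (suc n)) → ℤ
  D j = det (minor j M)
  E : Fin (suc (suc n)) → Fin (suc n) → ℤ
  E j r = det (replaceRow (minor j M) r (w′ j))
  t₁ t₂ t₃ t₄ : Fin (suc (suc n)) → ℤ
  t₁ j = sign j * M zero j * D j
  t₂ j = sign j * w j * D j
  t₃ j = sign j * M zero j * sumFin (E j)
  t₄ j = sign j * w j * sumFin (E j)
  expand : ∀ s m x d e → s * (m + x) * (d + e) ≡ s * m * d + s * x * d + s * m * e + s * x * e
  expand = solve-∀
  regroup : ∀ a b c → a + b + c + + 0 ≡ a + (b + c)
  regroup = solve-∀
  minor-replaceRow : ∀ r j → det (minor j (replaceRow M (suc r) w)) ≡ E j r
  minor-replaceRow r j = det-cong (λ r′ c → replaceRow-mapColumns (λ k → M (suc k)) (punchIn j) r w r′ c)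
  replaced : ∀ (first : Fin (suc (suc n)) → ℤ) →
    sumFin (λ j → sign j * first j * sumFin (E j))
    ≡ sumFin (λ r → det (replaceRow (replaceRow M (suc r) w) zero first))
  replaced first =
    trans (sumFin-cong (λ j → trans (sym (sumFin-*ˡ (sign j * first j) (E j)))
                                    (sumFin-cong (λ r → cong (sign j * first j *_) (sym (minor-replaceRow r j))))))
          (sumFin-comm (λ j r → sign j * first j * det (minor j (replaceRow M (suc r) w))))

det-replaceRow-ones : ∀ {n} (B : Matrix (suc n)) (s : ℤ) → (∀ j → sumFin (λ i → B i j) ≡ s) →
  ∀ i → s * det (replaceRow B i (λ _ → - (+ 1))) ≡ - det B
det-replaceRow-ones {n} B s columnSum i = begin
  s * det Y
    ≡⟨ cong (s *_) Y-toFront ⟩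
  s * (sign i * det (replaceRow X zero w))
    ≡⟨ commute s (sign i) (det (replaceRow X zero w)) ⟩
  sign i * (s * det (replaceRow X zero w))
    ≡⟨ cong (sign i *_) row₀ ⟩
  sign i * - det X
    ≡⟨ cong (λ z → sign i * - z) (det-toFront i B) ⟩
  sign i * - (sign i * det B)
    ≡⟨ cancel (sign i) (det B) ⟩
  - ((sign i * sign i) * det B)
    ≡⟨ cong (λ z → - (z * det B)) (sign*sign≡1 i) ⟩
  - (+ 1 * det B)
    ≡⟨ cong -_ (unit (det B)) ⟩
  - det B ∎
  where
  open ≡-Reasoning
  w : Fin (suc n) → ℤ
  w _ = - (+ 1)
  Y = replaceRow B i w
  X : Matrix (suc n)
  X a b = B (toFront i a) b
  commute : ∀ s g d → s * (g * d) ≡ g * (s * d)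
  commute = solve-∀
  cancel : ∀ g d → g * - (g * d) ≡ - ((g * g) * d)
  cancel = solve-∀
  unit : ∀ d → + 1 * d ≡ d
  unit = solve-∀
  rows : ∀ a b → Y (toFront i a) b ≡ replaceRow X zero w a b
  rows zero    b = cong (λ v → v b) (updateAt-updates i B)
  rows (suc k) b = cong (λ v → v b) (updateAt-minimal (punchIn i k) i B (punchInᵢ≢i i k))
  Y-toFront : det Y ≡ sign i * det (replaceRow X zero w)
  Y-toFront = trans (sym (unit (det Y))) (trans (cong (_* det Y) (sym (sign*sign≡1 i)))
                (trans (assoc (sign i) (det Y)) (cong (sign i *_) (trans (sym (det-toFront i Y)) (det-cong rows)))))
    where
    assoc : ∀ g d → g * g * d ≡ g * (g * d)
    assoc = solve-∀
  columnSumX : ∀ j → sumFin (λ r → X r j) ≡ s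
  columnSumX j = trans (sym (sumFin-punchIn (λ r → B r j) i)) (columnSum j)
  row₀ : s * det (replaceRow X zero w) ≡ - det X
  row₀ = begin
    s * det (replaceRow X zero w)
      ≡⟨ sym (sumFin-*ˡ s (λ j → sign j * w j * det (minor j X))) ⟩
    sumFin (λ j → s * (sign j * w j * det (minor j X)))
      ≡⟨ sumFin-cong (λ j → negate s (sign j) (det (minor j X))) ⟩
    sumFin (λ j → - (sign j * s * det (minor j X)))
      ≡⟨ sumFin-neg (λ j → sign j * s * det (minor j X)) ⟩
    - sumFin (λ j → sign j * s * det (minor j X))
      ≡⟨ cong -_ (sumFin-cong (λ j → cong (λ z → sign j * z * det (minor j X)) (sym (columnSumX j)))) ⟩
    - sumFin (λ j → sign j * sumFin (λ r → X r j) * det (minor j X))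
      ≡⟨ cong -_ (det-columnSums X) ⟩
    - det X ∎
    where
    negate : ∀ s g d → s * (g * - (+ 1) * d) ≡ - (g * s * d)
    negate = solve-∀

-- The matrix determinant lemma for the rank-one update B − J, J the all-ones matrix.
det-subtractOnes : ∀ {n} (B : Matrix (suc n)) (s : ℤ) → (∀ j → sumFin (λ i → B i j) ≡ s) →
  s * det (λ i j → B i j + - (+ 1)) ≡ (s - + (suc n)) * det B
det-subtractOnes {n} B s columnSum = begin
  s * det (λ i j → B i j + - (+ 1))
    ≡⟨ cong (s *_) (det-addToRows B (λ _ → - (+ 1))) ⟩
  s * (det B + sumFin R)
    ≡⟨ distrib s (det B) (sumFin R) ⟩
  s * det B + s * sumFin R
    ≡⟨ cong (_+_ (s * det B)) (trans (sym (sumFin-*ˡ s R)) (sumFin-cong (det-replaceRow-ones B s columnSum))) ⟩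
  s * det B + sumFin {suc n} (λ _ → - det B)
    ≡⟨ cong (_+_ (s * det B)) (sumFin-const {suc n} (- det B)) ⟩
  s * det B + + (suc n) * - det B
    ≡⟨ collect s (+ (suc n)) (det B) ⟩
  (s - + (suc n)) * det B ∎
  where
  open ≡-Reasoning
  R : Fin (suc n) → ℤ
  R i = det (replaceRow B i (λ _ → - (+ 1)))
  distrib : ∀ s a b → s * (a + b) ≡ s * a + s * b
  distrib = solve-∀
  collect : ∀ s n d → s * d + n * - d ≡ (s - n) * d
  collect = solve-∀

-- Characteristic polynomials

⌊⌋-true : ∀ {A : Set} (a? : Dec A) → A → ⌊ a? ⌋ ≡ true
⌊⌋-true a? a = trans (isYes≗does a?) (dec-true a? a)

⌊⌋-false : ∀ {A : Set} (a? : Dec A) → ¬ A → ⌊ a? ⌋ ≡ false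
⌊⌋-false a? ¬a = trans (isYes≗does a?) (dec-false a? ¬a)

⌊⌋-⇔ : ∀ {A B : Set} → A ⇔ B → (a? : Dec A) (b? : Dec B) → ⌊ a? ⌋ ≡ ⌊ b? ⌋
⌊⌋-⇔ A⇔B a? b? = trans (isYes≗does a?) (trans (does-⇔ A⇔B a? b?) (sym (isYes≗does b?)))

charMatrix : ∀ {n} → Digraph n → ℤ → Matrix n
charMatrix E λ′ i j = (if ⌊ i ≟ j ⌋ then λ′ else + 0) - adjMatrix E i j

induced : ∀ {n k} → Digraph n → (Fin k → Fin n) → Digraph k
induced E v i j = E (v i) (v j)

charPoly-cong : ∀ {n} {E E′ : Digraph n} → (∀ i j → E i j ≡ E′ i j) →
  ∀ λ′ → charPoly E λ′ ≡ charPoly E′ λ′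
charPoly-cong same λ′ =
  det-cong (λ i j → cong (λ b → (if ⌊ i ≟ j ⌋ then λ′ else + 0) - (if b then + 1 else + 0)) (same i j))

charPoly-inverse : ∀ {n} (E : Digraph n) λ′ → charPoly (inverse E) λ′ ≡ charPoly E λ′
charPoly-inverse E λ′ = trans (det-cong entries) (det-transpose (charMatrix E λ′))
  where
  entries : ∀ i j → charMatrix (inverse E) λ′ i j ≡ charMatrix E λ′ j i
  entries i j =
    cong (λ b → (if b then λ′ else + 0) - adjMatrix E j i) (⌊⌋-⇔ (mk⇔ sym sym) (i ≟ j) (j ≟ i))

charMatrix-induced : ∀ {n k} (E : Digraph n) {v : Fin k → Fin n} → Injective _≡_ _≡_ v →
  ∀ λ′ i j → charMatrix (induced E v) λ′ i j ≡ charMatrix E λ′ (v i) (v j)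
charMatrix-induced E {v} v-inj λ′ i j =
  cong (λ b → (if b then λ′ else + 0) - adjMatrix E (v i) (v j))
       (⌊⌋-⇔ (mk⇔ (cong v) v-inj) (i ≟ j) (v i ≟ v j))

charPoly-relabel : ∀ {n} (E : Digraph n) (σ : Fin n → Fin n) → Injective _≡_ _≡_ σ →
  ∀ λ′ → charPoly (induced E σ) λ′ ≡ charPoly E λ′
charPoly-relabel E σ σ-inj λ′ =
  trans (det-cong (charMatrix-induced E σ-inj λ′)) (det-relabel σ σ-inj (charMatrix E λ′))

charPoly-removeSource : ∀ {n} (E : Digraph (suc n)) u → (∀ w → E w u ≡ false) →
  ∀ λ′ → charPoly E λ′ ≡ λ′ * charPoly (induced E (punchIn u)) λ′
charPoly-removeSource E u no-arc λ′ =
  trans (det-column-single (charMatrix E λ′) u column)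
        (cong₂ _*_ diagonal (sym (det-cong (charMatrix-induced E (punchIn-injective u _ _) λ′))))
  where
  column : ∀ r → charMatrix E λ′ (punchIn u r) u ≡ + 0
  column r rewrite ⌊⌋-false (punchIn u r ≟ u) (punchInᵢ≢i u r) | no-arc (punchIn u r) = refl
  diagonal : charMatrix E λ′ u u ≡ λ′
  diagonal rewrite ⌊⌋-true (u ≟ u) refl | no-arc u = +-identityʳ λ′

⌊≟⌋≡toℕ≡ᵇ : ∀ {n} (i j : Fin n) → ⌊ i ≟ j ⌋ ≡ (toℕ i ≡ᵇ toℕ j)
⌊≟⌋≡toℕ≡ᵇ zero    zero    = refl
⌊≟⌋≡toℕ≡ᵇ zero    (suc j) = refl
⌊≟⌋≡toℕ≡ᵇ (suc i) zero    = refl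
⌊≟⌋≡toℕ≡ᵇ (suc i) (suc j) =
  trans (⌊⌋-⇔ (mk⇔ suc-injective (cong suc)) (suc i ≟ suc j) (i ≟ j)) (⌊≟⌋≡toℕ≡ᵇ i j)

bidiagonal : ℤ → ℤ → ∀ k → Matrix k
bidiagonal a b k r c = (if toℕ r ≡ᵇ toℕ c then a else + 0) + (if toℕ c ≡ᵇ suc (toℕ r) then b else + 0)

det-bidiagonal : ∀ a b k → det (bidiagonal a b k) ≡ a ^ k
det-bidiagonal a b zero    = refl
det-bidiagonal a b (suc k) =
  trans (det-column₀-single (bidiagonal a b (suc k)) (λ r → refl))
        (cong₂ _*_ (+-identityʳ a) (det-bidiagonal a b k))

cycleEntry : ℕ → ℤ → ℕ → ℕ → ℤ
cycleEntry m λ′ a b = (if a ≡ᵇ b then λ′ else + 0) - (if b ≡ᵇ suc a % suc m then + 1 else + 0)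

charMatrix-cycle : ∀ m λ′ i j → charMatrix (cycleDigraph m) λ′ i j ≡ cycleEntry m λ′ (toℕ i) (toℕ j)
charMatrix-cycle m λ′ i j
  rewrite ⌊≟⌋≡toℕ≡ᵇ i j | isYes≗does (toℕ j ℕ.≟ suc (toℕ i) % suc m) = refl

neg-if : ∀ (q : Bool) → - (if q then + 1 else + 0) ≡ (if q then - (+ 1) else + 0)
neg-if false = refl
neg-if true  = refl

sub-if-comm : ∀ (p q : Bool) (x : ℤ) →
  (if p then x else + 0) - (if q then + 1 else + 0) ≡ (if q then - (+ 1) else + 0) + (if p then x else + 0)
sub-if-comm p q x =
  trans (cong (_+_ (if p then x else + 0)) (neg-if q)) (+-comm (if p then x else + 0) (if q then - (+ 1) else + 0))

≡ᵇ-< : ∀ {a b} → a < b → (a ≡ᵇ b) ≡ false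
≡ᵇ-< {zero}  {suc b} _         = refl
≡ᵇ-< {suc a} {suc b} (s≤s a<b) = ≡ᵇ-< a<b

toℕ-punchIn-fromℕ : ∀ {n} (r : Fin n) → toℕ (punchIn (fromℕ n) r) ≡ toℕ r
toℕ-punchIn-fromℕ zero    = refl
toℕ-punchIn-fromℕ (suc r) = cong suc (toℕ-punchIn-fromℕ r)

module _ (m : ℕ) (λ′ : ℤ) where

  private
    C : Matrix (suc (suc m))
    C = charMatrix (cycleDigraph (suc m)) λ′
    last : Fin (suc m)
    last = fromℕ m

  cycle-minor₀ : ∀ r c → C (suc r) (suc c) ≡ bidiagonal λ′ (- (+ 1)) (suc m) r c
  cycle-minor₀ r c with ℕ.m≤n⇒m<n∨m≡n (ℕ.≤-pred (toℕ<n r))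
  ... | inj₁ r<m rewrite charMatrix-cycle (suc m) λ′ (suc r) (suc c)
    | m≤n⇒m%n≡m {suc (suc (toℕ r))} {suc m} (s≤s r<m) =
    cong (_+_ (if toℕ r ≡ᵇ toℕ c then λ′ else + 0)) (neg-if (toℕ c ≡ᵇ suc (toℕ r)))
  ... | inj₂ r≡m rewrite charMatrix-cycle (suc m) λ′ (suc r) (suc c)
    | trans (cong (λ t → suc (suc t) % suc (suc m)) r≡m) (n%n≡0 (suc (suc m)))
    | ≡ᵇ-< (subst (λ t → toℕ c < suc t) (sym r≡m) (toℕ<n c)) = refl

  cycle-minorLast : ∀ r c → C (punchIn (suc last) r) (suc c) ≡ bidiagonal (- (+ 1)) λ′ (suc m) c r
  cycle-minorLast r c rewrite charMatrix-cycle (suc m) λ′ (punchIn (suc last) r) (suc c) | toℕ-punchIn-fromℕ r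
    | m≤n⇒m%n≡m {suc (toℕ r)} {suc m} (toℕ<n r) =
    sub-if-comm (toℕ r ≡ᵇ suc (toℕ c)) (toℕ c ≡ᵇ toℕ r) λ′

  cycle-column₀ : ∀ k → C (suc (punchIn last k)) zero ≡ + 0
  cycle-column₀ k rewrite charMatrix-cycle (suc m) λ′ (suc (punchIn last k)) zero | toℕ-punchIn-fromℕ k
    | m≤n⇒m%n≡m {suc (suc (toℕ k))} {suc m} (s≤s (toℕ<n k)) = refl

  cycle-corner : C (suc last) zero ≡ - (+ 1)
  cycle-corner rewrite charMatrix-cycle (suc m) λ′ (suc last) zero
    | trans (cong (λ t → suc (suc t) % suc (suc m)) (toℕ-fromℕ m)) (n%n≡0 (suc (suc m))) = refl

  -- Expand along column zero: only the diagonal entry and the arc closing the cycle survive.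
  charPoly-cycle-suc : charPoly (cycleDigraph (suc m)) λ′ ≡ λ′ ^ suc (suc m) - + 1
  charPoly-cycle-suc = begin
    det C
      ≡⟨ det-expandColumn₀ C ⟩
    sign {suc (suc m)} zero * C zero zero * det (λ r c → C (suc r) (suc c)) + sumFin closing
      ≡⟨ cong₂ _+_ (cong (sign {suc (suc m)} zero * C zero zero *_)
                         (trans (det-cong cycle-minor₀) (det-bidiagonal λ′ (- (+ 1)) (suc m))))
                   (sumFin-single closing last
                      (λ k → trans (cong (λ x → sign (suc (punchIn last k)) * x * cofactor (punchIn last k))
                                         (cycle-column₀ k))
                                   (vanish (sign (suc (punchIn last k))) (cofactor (punchIn last k))))) ⟩
    + 1 * (λ′ - + 0) * λ′ ^ suc m + closing last
      ≡⟨ cong (_+_ (+ 1 * (λ′ - + 0) * λ′ ^ suc m))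
              (cong₃ (cong (λ t → (- (+ 1)) ^ suc t) (toℕ-fromℕ m)) cycle-corner cofactor-last) ⟩
    + 1 * (λ′ - + 0) * λ′ ^ suc m + (- (+ 1)) ^ suc m * - (+ 1) * (- (+ 1)) ^ suc m
      ≡⟨ rearrange λ′ (λ′ ^ suc m) ((- (+ 1)) ^ suc m) ⟩
    λ′ ^ suc (suc m) - (- (+ 1)) ^ suc m * (- (+ 1)) ^ suc m
      ≡⟨ cong (λ z → λ′ ^ suc (suc m) - z) (-1^k*-1^k≡1 (suc m)) ⟩
    λ′ ^ suc (suc m) - + 1 ∎
    where
    open ≡-Reasoning
    cofactor : Fin (suc m) → ℤ
    cofactor i = det (λ r c → C (punchIn (suc i) r) (suc c))
    closing : Fin (suc m) → ℤ
    closing i = sign (suc i) * C (suc i) zero * cofactor i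
    cofactor-last : cofactor last ≡ (- (+ 1)) ^ suc m
    cofactor-last = trans (sym (det-transpose (λ r c → C (punchIn (suc last) r) (suc c))))
                          (trans (det-cong (λ r c → cycle-minorLast c r)) (det-bidiagonal (- (+ 1)) λ′ (suc m)))
    vanish : ∀ s d → s * + 0 * d ≡ + 0
    vanish = solve-∀
    cong₃ : ∀ {a b c a′ b′ c′ : ℤ} → a ≡ a′ → b ≡ b′ → c ≡ c′ → a * b * c ≡ a′ * b′ * c′
    cong₃ refl refl refl = refl
    rearrange : ∀ l p q → + 1 * (l - + 0) * p + q * - (+ 1) * q ≡ l * p - q * q
    rearrange = solve-∀

charPoly-cycle : ∀ m λ′ → charPoly (cycleDigraph m) λ′ ≡ λ′ ^ suc m - + 1
charPoly-cycle zero    λ′ = loop λ′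
  where
  loop : ∀ l → + 1 * (l - + 1) * + 1 + + 0 ≡ l * + 1 - + 1
  loop = solve-∀
charPoly-cycle (suc m) λ′ = charPoly-cycle-suc m λ′

-- Functional digraphs

_IsGraphOf_ : ∀ {n} → Digraph n → (Fin n → Fin n) → Set
E IsGraphOf g = ∀ x y → (E x y ≡ true) ⇔ (y ≡ g x)

iterate : ∀ {n} → (Fin n → Fin n) → ℕ → Fin n → Fin n
iterate g zero    x = x
iterate g (suc t) x = iterate g t (g x)

iterate-+ : ∀ {n} (g : Fin n → Fin n) t d x → iterate g (t ℕ.+ d) x ≡ iterate g d (iterate g t x)
iterate-+ g zero    d x = refl
iterate-+ g (suc t) d x = iterate-+ g t d (g x)

_∈Image_ : ∀ {n k} → Fin n → (Fin k → Fin n) → Set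
x ∈Image v = ∃ λ c → v c ≡ x

Reaches : ∀ {n k} → (Fin n → Fin n) → (Fin k → Fin n) → Fin n → Set
Reaches g v x = ∃ λ t → iterate g t x ∈Image v

∈Image? : ∀ {n k} (x : Fin n) (v : Fin k → Fin n) → Dec (x ∈Image v)
∈Image? x v = any? (λ c → v c ≟ x)

maxFin : ∀ {n} → (Fin n → ℕ) → ℕ
maxFin {zero}  f = 0
maxFin {suc n} f = f zero ⊔ maxFin (λ i → f (suc i))

≤-maxFin : ∀ {n} (f : Fin n → ℕ) i → f i ≤ maxFin f
≤-maxFin f zero    = ℕ.m≤m⊔n (f zero) _
≤-maxFin f (suc i) = ℕ.≤-trans (≤-maxFin (λ i → f (suc i)) i) (ℕ.m≤n⊔m (f zero) _)

-- equivariant says that g maps the image of v into itself; for a cycle, h is its successor map.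
module ClosedImage {n k} (g : Fin n → Fin n) (v : Fin k → Fin n) (h : Fin k → Fin k)
                   (equivariant : ∀ c → g (v c) ≡ v (h c)) where

  iterate-∈Image : ∀ t {x} → x ∈Image v → iterate g t x ∈Image v
  iterate-∈Image zero    x∈v       = x∈v
  iterate-∈Image (suc t) (c , refl) = iterate-∈Image t (h c , sym (equivariant c))

  reaches-uniformly : (∀ x → Reaches g v x) → Σ ℕ λ T → ∀ x → iterate g T x ∈Image v
  reaches-uniformly reach = T , within
    where
    T = maxFin (λ x → proj₁ (reach x))
    within : ∀ x → iterate g T x ∈Image v
    within x = subst (_∈Image v)
                     (trans (sym (iterate-+ g t (T ∸ t) x)) (cong (λ s → iterate g s x) (ℕ.m+[n∸m]≡n t≤T)))
                     (iterate-∈Image (T ∸ t) (proj₂ (reach x)))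
      where
      t = proj₁ (reach x)
      t≤T : t ≤ T
      t≤T = ≤-maxFin (λ x → proj₁ (reach x)) x

  reaches-g : ∀ {x} → Reaches g v x → Reaches g v (g x)
  reaches-g (zero  , x∈v) = zero , iterate-∈Image 1 x∈v
  reaches-g (suc t , p)   = t , p

  reaches-connected : ∀ {E : Digraph n} → E IsGraphOf g → ∀ {a b} → Conn E a b → Reaches g v a → Reaches g v b
  reaches-connected graph here                = λ r → r
  reaches-connected graph (fwd {v = x} {w} e c) =
    λ r → subst (Reaches g v) (sym (Equivalence.to (graph x w) e)) (reaches-g (reaches-connected graph c r))
  reaches-connected graph (bwd {v = x} {w} e c) =
    λ r → suc-step (subst (Reaches g v) (Equivalence.to (graph w x) e) (reaches-connected graph c r))
    where
    suc-step : Reaches g v (g w) → Reaches g v w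
    suc-step (t , p) = suc t , p

  -- A g-preimage of a vertex whose t-th iterate is off the image has its (t + 1)-th iterate off the image, so
  -- walking backwards along g must stop at a vertex without g-preimage before t reaches the uniform bound T.
  leaf-exists-above : ∀ T → (∀ x → iterate g T x ∈Image v) → ∀ d {t} → d ℕ.+ t ≡ T →
    ∀ x → ¬ (iterate g t x ∈Image v) → Σ (Fin n) λ u → ¬ (u ∈Image v) × (∀ w → g w ≢ u)
  leaf-exists-above T bound zero    refl x off = ⊥-elim (off (bound x))
  leaf-exists-above T bound (suc d) {t} d+t≡T x off with any? (λ w → g w ≟ x)
  ... | yes (w , gw≡x) =
    leaf-exists-above T bound d (trans (ℕ.+-suc d t) d+t≡T) w
                      (subst (λ y → ¬ (iterate g t y ∈Image v)) (sym gw≡x) off)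
  ... | no no-preimage = x , (λ x∈v → off (iterate-∈Image t x∈v)) , (λ w gw≡x → no-preimage (w , gw≡x))

  leaf-exists : (∀ x → Reaches g v x) → ¬ (∀ x → x ∈Image v) →
    Σ (Fin n) λ u → ¬ (u ∈Image v) × (∀ w → g w ≢ u)
  leaf-exists reach not-onto with reaches-uniformly reach | ¬∀⟶∃¬ n _ (λ x → ∈Image? x v) not-onto
  ... | T , bound | x , off = leaf-exists-above T bound T (ℕ.+-identityʳ T) x off

module DeleteSource {n} {E : Digraph (suc n)} {g : Fin (suc n) → Fin (suc n)} (graph : E IsGraphOf g)
                    (u : Fin (suc n)) (no-preimage : ∀ w → g w ≢ u) where

  g∖u : Fin n → Fin n
  g∖u i = punchOut (λ u≡g → no-preimage (punchIn u i) (sym u≡g))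

  punchIn-g∖u : ∀ i → punchIn u (g∖u i) ≡ g (punchIn u i)
  punchIn-g∖u i = punchIn-punchOut _

  no-arc-in : ∀ w → E w u ≡ false
  no-arc-in w = ¬-not (λ e → no-preimage w (sym (Equivalence.to (graph w u) e)))

  induced-IsGraphOf : induced E (punchIn u) IsGraphOf g∖u
  induced-IsGraphOf x y = mk⇔
    (λ e → punchIn-injective u y (g∖u x) (trans (Equivalence.to (graph _ _) e) (sym (punchIn-g∖u x))))
    (λ y≡ → Equivalence.from (graph _ _) (trans (cong (punchIn u) y≡) (punchIn-g∖u x)))

  punchIn-iterate : ∀ t x → punchIn u (iterate g∖u t x) ≡ iterate g t (punchIn u x)
  punchIn-iterate zero    x = refl
  punchIn-iterate (suc t) x = trans (punchIn-iterate t (g∖u x)) (cong (iterate g t) (punchIn-g∖u x))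

  module _ {k} (v : Fin k → Fin (suc n)) (avoids : ∀ c → v c ≢ u) where

    v∖u : Fin k → Fin n
    v∖u c = punchOut (λ u≡v → avoids c (sym u≡v))

    punchIn-v∖u : ∀ c → punchIn u (v∖u c) ≡ v c
    punchIn-v∖u c = punchIn-punchOut _

    v∖u-injective : Injective _≡_ _≡_ v → Injective _≡_ _≡_ v∖u
    v∖u-injective v-inj {c} {d} e = v-inj (trans (sym (punchIn-v∖u c)) (trans (cong (punchIn u) e) (punchIn-v∖u d)))

    v∖u-equivariant : ∀ {h : Fin k → Fin k} → (∀ c → g (v c) ≡ v (h c)) →
      ∀ c → g∖u (v∖u c) ≡ v∖u (h c)
    v∖u-equivariant {h} equivariant c = punchIn-injective u _ _ (begin
      punchIn u (g∖u (v∖u c)) ≡⟨ punchIn-g∖u (v∖u c) ⟩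
      g (punchIn u (v∖u c))   ≡⟨ cong g (punchIn-v∖u c) ⟩
      g (v c)                 ≡⟨ equivariant c ⟩
      v (h c)                 ≡⟨ sym (punchIn-v∖u (h c)) ⟩
      punchIn u (v∖u (h c))   ∎)
      where open ≡-Reasoning

    v∖u-reaches : ∀ {x} → Reaches g v (punchIn u x) → Reaches g∖u v∖u x
    v∖u-reaches {x} (t , c , vc≡) =
      t , c , punchIn-injective u _ _ (trans (punchIn-v∖u c) (trans vc≡ (sym (punchIn-iterate t x))))

    induced-v∖u : ∀ i j → induced (induced E (punchIn u)) v∖u i j ≡ induced E v i j
    induced-v∖u i j = cong₂ E (punchIn-v∖u i) (punchIn-v∖u j)

charPoly-onto : ∀ {n k} (E : Digraph n) (v : Fin k → Fin n) → Injective _≡_ _≡_ v → (∀ x → x ∈Image v) →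
  ∀ λ′ → charPoly E λ′ ≡ λ′ ^ (n ∸ k) * charPoly (induced E v) λ′
charPoly-onto {n} {k} E v v-inj onto λ′ =
  relabel (ℕ.≤-antisym (injective⇒≤ v-inj) (injective⇒≤ section-inj)) v v-inj
  where
  section-inj : Injective _≡_ _≡_ (λ x → proj₁ (onto x))
  section-inj {x} {y} e = trans (sym (proj₂ (onto x))) (trans (cong v e) (proj₂ (onto y)))
  relabel : k ≡ n → (v : Fin k → Fin n) → Injective _≡_ _≡_ v →
    charPoly E λ′ ≡ λ′ ^ (n ∸ k) * charPoly (induced E v) λ′
  relabel refl v v-inj rewrite ℕ.n∸n≡0 n =
    trans (sym (charPoly-relabel E v v-inj λ′)) (sym (unit (charPoly (induced E v) λ′)))
    where
    unit : ∀ c → + 1 * c ≡ c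
    unit = solve-∀

charPoly-peel : ∀ {n k} (E : Digraph n) (g : Fin n → Fin n) → E IsGraphOf g →
  ∀ (v : Fin k → Fin n) (h : Fin k → Fin k) → Injective _≡_ _≡_ v →
  (∀ c → g (v c) ≡ v (h c)) → (∀ x → Reaches g v x) →
  ∀ λ′ → charPoly E λ′ ≡ λ′ ^ (n ∸ k) * charPoly (induced E v) λ′
charPoly-peel {zero}      E g graph v h v-inj equivariant reach λ′ = charPoly-onto E v v-inj (λ ()) λ′
charPoly-peel {suc n} {k} E g graph v h v-inj equivariant reach λ′
  with all? (λ x → ∈Image? x v)
... | yes onto = charPoly-onto E v v-inj onto λ′
... | no not-onto with ClosedImage.leaf-exists g v h equivariant reach not-onto
... | u , off , no-preimage = begin
  charPoly E λ′
    ≡⟨ charPoly-removeSource E u no-arc-in λ′ ⟩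
  λ′ * charPoly (induced E (punchIn u)) λ′
    ≡⟨ cong (λ′ *_) (charPoly-peel (induced E (punchIn u)) g∖u induced-IsGraphOf (v∖u v avoids) h
                       (v∖u-injective v avoids v-inj) (v∖u-equivariant v avoids equivariant)
                       (λ x → v∖u-reaches v avoids (reach (punchIn u x))) λ′) ⟩
  λ′ * (λ′ ^ (n ∸ k) * charPoly (induced (induced E (punchIn u)) (v∖u v avoids)) λ′)
    ≡⟨ cong (λ c → λ′ * (λ′ ^ (n ∸ k) * c)) (charPoly-cong (induced-v∖u v avoids) λ′) ⟩
  λ′ * (λ′ ^ (n ∸ k) * charPoly (induced E v) λ′)
    ≡⟨ assoc λ′ (λ′ ^ (n ∸ k)) (charPoly (induced E v) λ′) ⟩
  λ′ ^ suc (n ∸ k) * charPoly (induced E v) λ′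
    ≡⟨ cong (λ e → λ′ ^ e * charPoly (induced E v) λ′) (sym (ℕ.+-∸-assoc 1 k≤n)) ⟩
  λ′ ^ (suc n ∸ k) * charPoly (induced E v) λ′ ∎
  where
  open ≡-Reasoning
  open DeleteSource graph u no-preimage
  avoids : ∀ c → v c ≢ u
  avoids c vc≡u = off (c , vc≡u)
  k≤n : k ≤ n
  k≤n = injective⇒≤ (v∖u-injective v avoids v-inj)
  assoc : ∀ a b c → a * (b * c) ≡ a * b * c
  assoc = solve-∀

cycle-next : ∀ m → Fin (suc m) → Fin (suc m)
cycle-next m i = fromℕ< (m%n<n (suc (toℕ i)) (suc m))

cycle-next-arc : ∀ m i → cycleDigraph m i (cycle-next m i) ≡ true
cycle-next-arc m i =
  ⌊⌋-true (toℕ (cycle-next m i) ℕ.≟ suc (toℕ i) % suc m) (toℕ-fromℕ< (m%n<n (suc (toℕ i)) (suc m)))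

cycle-prev : ∀ m → Fin (suc m) → Fin (suc m)
cycle-prev m       zero    = fromℕ m
cycle-prev (suc m) (suc j) = inject₁ j

cycle-prev-arc : ∀ m j → cycleDigraph m (cycle-prev m j) j ≡ true
cycle-prev-arc m zero = ⌊⌋-true (0 ℕ.≟ suc (toℕ (fromℕ m)) % suc m)
  (sym (trans (cong (λ t → suc t % suc m) (toℕ-fromℕ m)) (n%n≡0 (suc m))))
cycle-prev-arc (suc m) (suc j) = ⌊⌋-true (suc (toℕ j) ℕ.≟ suc (toℕ (inject₁ j)) % suc (suc m))
  (sym (trans (cong (λ t → suc t % suc (suc m)) (toℕ-inject₁ j)) (m≤n⇒m%n≡m (toℕ<n j))))

true⇔true⇒≡ : ∀ {a b : Bool} → (a ≡ true → b ≡ true) → (b ≡ true → a ≡ true) → a ≡ b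
true⇔true⇒≡ {false} {false} _  _  = refl
true⇔true⇒≡ {false} {true}  _  b⇒a = b⇒a refl
true⇔true⇒≡ {true}  {false} a⇒b _  = sym (a⇒b refl)
true⇔true⇒≡ {true}  {true}  _  _  = refl

module Embedded {n k} {E : Digraph n} {g : Fin n → Fin n} (graph : E IsGraphOf g)
                {D : Digraph k} {v : Fin k → Fin n} (embeds : ∀ i j → D i j ≡ true → E (v i) (v j) ≡ true)
                {h : Fin k → Fin k} (out-arc : ∀ i → D i (h i) ≡ true) where

  equivariant : ∀ i → g (v i) ≡ v (h i)
  equivariant i = sym (Equivalence.to (graph _ _) (embeds i (h i) (out-arc i)))

  induced-embedded : Injective _≡_ _≡_ v → ∀ i j → induced E v i j ≡ D i j
  induced-embedded v-inj i j = true⇔true⇒≡ arc-in-D (embeds i j)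
    where
    arc-in-D : E (v i) (v j) ≡ true → D i j ≡ true
    arc-in-D e = subst (λ j → D i j ≡ true)
                       (sym (v-inj (trans (Equivalence.to (graph _ _) e) (equivariant i)))) (out-arc i)

conn-inverse : ∀ {n} {E : Digraph n} {a b} → Conn E a b → Conn (inverse E) a b
conn-inverse here      = here
conn-inverse (fwd e c) = bwd e (conn-inverse c)
conn-inverse (bwd e c) = fwd e (conn-inverse c)

charPoly-embedded : ∀ {n m} (E : Digraph n) (g : Fin n → Fin n) → E IsGraphOf g → Connected E →
  ∀ (D : Digraph (suc m)) (h : Fin (suc m) → Fin (suc m)) (v : Fin (suc m) → Fin n) → Injective _≡_ _≡_ v →
  (∀ i j → D i j ≡ true → E (v i) (v j) ≡ true) → (∀ i → D i (h i) ≡ true) →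
  ∀ λ′ → charPoly E λ′ ≡ λ′ ^ (n ∸ suc m) * charPoly D λ′
charPoly-embedded {n} {m} E g graph connected D h v v-inj embeds out-arc λ′ =
  trans (charPoly-peel E g graph v h v-inj equivariant reach λ′)
        (cong (λ′ ^ (n ∸ suc m) *_) (charPoly-cong (induced-embedded v-inj) λ′))
  where
  open Embedded graph embeds out-arc
  reach : ∀ x → Reaches g v x
  reach x = ClosedImage.reaches-connected g v h equivariant graph (connected (v zero) x) (0 , zero , refl)

charPoly-unicyclic : ∀ {n} (F : Digraph (suc n)) → Connected F →
  (IsDigraphFunction F ⊎ IsInverseOfDigraphFunction F) →
  ∀ m (v : Fin (suc m) → Fin (suc n)) → IsDirectedCycle F m v →
  ∀ λ′ → charPoly F λ′ ≡ λ′ ^ (suc n ∸ suc m) * charPoly (cycleDigraph m) λ′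
charPoly-unicyclic F connected (inj₁ (g , graph)) m v (v-inj , arcs) λ′ =
  charPoly-embedded F g graph connected (cycleDigraph m) (cycle-next m) v v-inj arcs (cycle-next-arc m) λ′
charPoly-unicyclic {n} F connected (inj₂ (g , graph)) m v (v-inj , arcs) λ′ = begin
  charPoly F λ′
    ≡⟨ sym (charPoly-inverse F λ′) ⟩
  charPoly (inverse F) λ′
    ≡⟨ charPoly-embedded (inverse F) g graph (λ a b → conn-inverse (connected a b))
         (inverse (cycleDigraph m)) (cycle-prev m) v v-inj (λ i j → arcs j i) (cycle-prev-arc m) λ′ ⟩
  λ′ ^ (suc n ∸ suc m) * charPoly (inverse (cycleDigraph m)) λ′
    ≡⟨ cong (λ′ ^ (suc n ∸ suc m) *_) (charPoly-inverse (cycleDigraph m) λ′) ⟩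
  λ′ ^ (suc n ∸ suc m) * charPoly (cycleDigraph m) λ′ ∎
  where open ≡-Reasoning

-- Complements of regular digraphs

outDegree : ∀ {n} → Digraph n → Fin n → ℤ
outDegree E x = sumFin (adjMatrix E x)

outDegree-graph : ∀ {n} {E : Digraph (suc n)} {g : Fin (suc n) → Fin (suc n)} → E IsGraphOf g →
  ∀ x → outDegree E x ≡ + 1
outDegree-graph {E = E} {g} graph x =
  trans (sumFin-single (adjMatrix E x) (g x) others)
        (cong (λ b → if b then + 1 else + 0) (Equivalence.from (graph x (g x)) refl))
  where
  others : ∀ k → adjMatrix E x (punchIn (g x) k) ≡ + 0
  others k = cong (λ b → if b then + 1 else + 0)
                  (¬-not (λ e → punchInᵢ≢i (g x) k (Equivalence.to (graph x _) e)))

complement-inverse : ∀ {n} (E : Digraph n) i j → complement (inverse E) i j ≡ inverse (complement E) i j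
complement-inverse E i j = cong (λ b → not (E j i) ∧ not b) (⌊⌋-⇔ (mk⇔ sym sym) (i ≟ j) (j ≟ i))

-- λI − A(Eᶜ) = B − J with B = (λ + 1)I + A(E) = −(μI − A(E)), μ = −(λ + 1); the row sums of B are λ + 1 + r.
charPoly-complement : ∀ {n} (E : Digraph (suc n)) → Simple E → ∀ r → (∀ x → outDegree E x ≡ + r) →
  ∀ λ′ → (λ′ + + suc r) * charPoly (complement E) λ′
         ≡ (λ′ + + suc r - + suc n) * ((- (+ 1)) ^ suc n * charPoly E (- (λ′ + + 1)))
charPoly-complement {n} E simple r regular λ′ = begin
  s * charPoly (complement E) λ′
    ≡⟨ cong (s *_) (trans (det-cong complement-entries) (sym (det-transpose (λ i j → B i j + - (+ 1))))) ⟩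
  s * det (λ i j → transpose B i j + - (+ 1))
    ≡⟨ det-subtractOnes (transpose B) s rowSum ⟩
  (s - + suc n) * det (transpose B)
    ≡⟨ cong ((s - + suc n) *_) (trans (det-transpose B) (trans (det-cong B-entries) (det-neg (charMatrix E μ)))) ⟩
  (s - + suc n) * ((- (+ 1)) ^ suc n * charPoly E μ) ∎
  where
  open ≡-Reasoning
  s = λ′ + + suc r
  μ = - (λ′ + + 1)
  diagonal : Fin (suc n) → Fin (suc n) → ℤ
  diagonal i j = if ⌊ i ≟ j ⌋ then λ′ + + 1 else + 0
  B : Matrix (suc n)
  B i j = diagonal i j + adjMatrix E i j
  complement-entries : ∀ i j → charMatrix (complement E) λ′ i j ≡ B i j + - (+ 1)
  complement-entries i j with i ≟ j
  ... | yes refl rewrite simple i = shift λ′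
    where
    shift : ∀ l → l - + 0 ≡ l + + 1 + + 0 + - (+ 1)
    shift = solve-∀
  ... | no _ with E i j
  ... | true  = refl
  ... | false = refl
  B-entries : ∀ i j → B i j ≡ - charMatrix E μ i j
  B-entries i j = negate ⌊ i ≟ j ⌋ (adjMatrix E i j)
    where
    negate : ∀ (b : Bool) (a : ℤ) → (if b then λ′ + + 1 else + 0) + a ≡ - ((if b then μ else + 0) - a)
    negate false a = off-diagonal a
      where
      off-diagonal : ∀ a → + 0 + a ≡ - (+ 0 - a)
      off-diagonal = solve-∀
    negate true  a = on-diagonal λ′ a
      where
      on-diagonal : ∀ l a → l + + 1 + a ≡ - (- (l + + 1) - a)
      on-diagonal = solve-∀
  rowSum : ∀ i → sumFin (λ j → B i j) ≡ s
  rowSum i = begin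
    sumFin (λ j → diagonal i j + adjMatrix E i j)
      ≡⟨ sumFin-+ (diagonal i) (adjMatrix E i) ⟩
    sumFin (diagonal i) + outDegree E i
      ≡⟨ cong₂ _+_ (trans (sumFin-single (diagonal i) i off-diagonal) on-diagonal) (regular i) ⟩
    λ′ + + 1 + + r
      ≡⟨ trans (+-assoc λ′ (+ 1) (+ r)) (cong (_+_ λ′) (sym (pos-+ 1 r))) ⟩
    s ∎
    where
    off-diagonal : ∀ k → diagonal i (punchIn i k) ≡ + 0
    off-diagonal k = cong (λ b → if b then λ′ + + 1 else + 0)
                          (⌊⌋-false (i ≟ punchIn i k) (λ e → punchInᵢ≢i i k (sym e)))
    on-diagonal : diagonal i i ≡ λ′ + + 1
    on-diagonal = cong (λ b → if b then λ′ + + 1 else + 0) (⌊⌋-true (i ≟ i) refl)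

charPoly-complement-unicyclic : ∀ {n} (F : Digraph (suc n)) → (IsDigraphFunction F ⊎ IsInverseOfDigraphFunction F) →
  Simple F → ∀ λ′ → (λ′ + + 2) * charPoly (complement F) λ′
                    ≡ (λ′ + + 2 - + suc n) * ((- (+ 1)) ^ suc n * charPoly F (- (λ′ + + 1)))
charPoly-complement-unicyclic F (inj₁ (g , graph)) simple λ′ =
  charPoly-complement F simple 1 (outDegree-graph graph) λ′
charPoly-complement-unicyclic {n} F (inj₂ (g , graph)) simple λ′ = begin
  (λ′ + + 2) * charPoly (complement F) λ′
    ≡⟨ cong ((λ′ + + 2) *_) (trans (sym (charPoly-inverse (complement F) λ′))
                                   (charPoly-cong (λ i j → sym (complement-inverse F i j)) λ′)) ⟩
  (λ′ + + 2) * charPoly (complement (inverse F)) λ′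
    ≡⟨ charPoly-complement (inverse F) simple 1 (outDegree-graph graph) λ′ ⟩
  (λ′ + + 2 - + suc n) * ((- (+ 1)) ^ suc n * charPoly (inverse F) (- (λ′ + + 1)))
    ≡⟨ cong (λ c → (λ′ + + 2 - + suc n) * ((- (+ 1)) ^ suc n * c)) (charPoly-inverse F (- (λ′ + + 1))) ⟩
  (λ′ + + 2 - + suc n) * ((- (+ 1)) ^ suc n * charPoly F (- (λ′ + + 1))) ∎
  where open ≡-Reasoning

[-x]^p≡[-1]^p*x^p : ∀ p x → (- x) ^ p ≡ (- (+ 1)) ^ p * x ^ p
[-x]^p≡[-1]^p*x^p zero    x = refl
[-x]^p≡[-1]^p*x^p (suc p) x = trans (cong (- x *_) ([-x]^p≡[-1]^p*x^p p x)) (regroup x ((- (+ 1)) ^ p) (x ^ p))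
  where
  regroup : ∀ x a b → - x * (a * b) ≡ (- (+ 1)) * a * (x * b)
  regroup = solve-∀

complement-polynomial : ∀ (l : ℤ) (N d k : ℕ) → d ℕ.+ k ≡ N →
  (l + + 2 - + N) * ((- (+ 1)) ^ N * ((- (l + + 1)) ^ d * ((- (l + + 1)) ^ k - + 1)))
  ≡ (l + + 1) ^ d * (l - + N + + 2) * ((l + + 1) ^ k - (- (+ 1)) ^ k)
complement-polynomial l .(d ℕ.+ k) d k refl
  rewrite ^-distribˡ-+-* (- (+ 1)) d k | [-x]^p≡[-1]^p*x^p d (l + + 1) | [-x]^p≡[-1]^p*x^p k (l + + 1) =
  trans (regroup (l + + 2 - + (d ℕ.+ k)) εd εk A Bk)
    (trans (cong₂ (λ a b → a * ((l + + 2 - + (d ℕ.+ k)) * A * (b * Bk - εk))) (-1^k*-1^k≡1 d) (-1^k*-1^k≡1 k))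
           (simplify l (+ (d ℕ.+ k)) A Bk εk))
  where
  εd = (- (+ 1)) ^ d
  εk = (- (+ 1)) ^ k
  A = (l + + 1) ^ d
  Bk = (l + + 1) ^ k
  regroup : ∀ L εd εk A Bk → L * ((εd * εk) * ((εd * A) * (εk * Bk - + 1)))
                            ≡ (εd * εd) * (L * A * ((εk * εk) * Bk - εk))
  regroup = solve-∀
  simplify : ∀ l N A Bk εk → + 1 * ((l + + 2 - N) * A * (+ 1 * Bk - εk)) ≡ A * (l - N + + 2) * (Bk - εk)
  simplify = solve-∀

theorem6p3 : ∀ (n : ℕ) (F : Digraph (suc n)) →
    Connected F →
    (IsDigraphFunction F ⊎ IsInverseOfDigraphFunction F) →
    ∀ (m : ℕ) (v : Fin (suc m) → Fin (suc n)) → IsDirectedCycle F m v →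
    (∀ (λ′ : ℤ) →
       (charPoly F λ′ ≡ (λ′ ^ (suc n ∸ suc m)) * charPoly (cycleDigraph m) λ′)
       × (charPoly (cycleDigraph m) λ′ ≡ (λ′ ^ suc m) - + 1))
    × (Simple F → ∀ (λ′ : ℤ) →
         (λ′ + + 2) * charPoly (complement F) λ′
           ≡ ((λ′ + + 1) ^ (suc n ∸ suc m)) * (λ′ - + (suc n) + + 2)
             * (((λ′ + + 1) ^ suc m) - ((- (+ 1)) ^ suc m)))
theorem6p3 n F connected unicyclic m v cycle = (λ λ′ → part-a1 λ′ , charPoly-cycle m λ′) , part-a2
  where
  open ≡-Reasoning
  part-a1 : ∀ λ′ → charPoly F λ′ ≡ λ′ ^ (suc n ∸ suc m) * charPoly (cycleDigraph m) λ′
  part-a1 = charPoly-unicyclic F connected unicyclic m v cycle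
  part-a2 : Simple F → ∀ λ′ → (λ′ + + 2) * charPoly (complement F) λ′
    ≡ (λ′ + + 1) ^ (suc n ∸ suc m) * (λ′ - + (suc n) + + 2) * ((λ′ + + 1) ^ suc m - (- (+ 1)) ^ suc m)
  part-a2 simple λ′ = begin
    (λ′ + + 2) * charPoly (complement F) λ′
      ≡⟨ charPoly-complement-unicyclic F unicyclic simple λ′ ⟩
    (λ′ + + 2 - + suc n) * ((- (+ 1)) ^ suc n * charPoly F μ)
      ≡⟨ cong (λ c → (λ′ + + 2 - + suc n) * ((- (+ 1)) ^ suc n * c))
              (trans (part-a1 μ) (cong (μ ^ (suc n ∸ suc m) *_) (charPoly-cycle m μ))) ⟩
    (λ′ + + 2 - + suc n) * ((- (+ 1)) ^ suc n * (μ ^ (suc n ∸ suc m) * (μ ^ suc m - + 1)))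
      ≡⟨ complement-polynomial λ′ (suc n) (suc n ∸ suc m) (suc m) (ℕ.m∸n+n≡m (injective⇒≤ (proj₁ cycle))) ⟩
    (λ′ + + 1) ^ (suc n ∸ suc m) * (λ′ - + (suc n) + + 2) * ((λ′ + + 1) ^ suc m - (- (+ 1)) ^ suc m) ∎
    where
    μ = - (λ′ + + 1)
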